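{- Let $r\ge 2$, $n\ge 2r$, and let $H\subseteq\binom{\Omega_n}{r}$ be $M_1^{(r)}$-saturated. Then: (1) every $v_i\in\Omega_n$ lies in at least one edge of $H$ (so $\lambda(v_i)$ and $\rho(v_i)$ are well defined); (2) for all $v_i$, $\lambda(v_i)\notin[v_{i-r+2},v_{i+r-1}]$ and $\rho(v_i)\notin[v_{i-r+1},v_{i+r-2}]$; (3) for all $v_i$, $\lambda(v_i)<v_i<\rho(v_i)\le\lambda(v_i)$; (4) if $v_j\in[\rho(v_i),\lambda(v_i)]$, then every $e\in\binom{\Omega_n}{r}$ with $\{v_i,v_j\}\subseteq e$ belongs to $H$.
   Context: $\Omega_n=\{v_0,\dots,v_{n-1}\}$ carries the cyclic (clockwise) order $v_0<\dots<v_{n-1}<v_0$; indices of $v$ are modulo $n$. A chain $x_1<x_2<\dots$ of points means they appear in this clockwise cyclic order; "$\rho(v_i)\le\lambda(v_i)$" in (3) allows $\rho(v_i)=\lambda(v_i)$, i.e. (3) says $\lambda(v_i),v_i,\rho(v_i)$ occur clockwise in this order with $\lambda(v_i),\rho(v_i)\ne v_i$, possibly $\rho(v_i)=\lambda(v_i)$. For $a,b\in\Omega_n$, $(a,b)$ is the set of points strictly between $a$ and $b$ travelling clockwise from $a$ to $b$, and $[a,b]=(a,b)\cup\{a,b\}$. Two $r$-sets $h_1,h_2$ form a copy of $M_1^{(r)}$ if they are disjoint and there are $a,b$ with $h_1\subseteq[a,b]$, $h_2\subseteq(b,a)$. $H$ is $M_1^{(r)}$-saturated if no two edges of $H$ form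 a copy of $M_1^{(r)}$ and every $e\in\binom{\Omega_n}{r}\setminus H$ forms a copy with some edge of $H$. For $v_i$ of positive degree, $\lambda(v_i)$ is the unique $v_j$ such that some $h\in H$ has $v_i\in h\subseteq[v_j,v_i]$ but no $h\in H$ has $v_i\in h\subseteq[v_{j+1},v_i]$; $\rho(v_i)$ is the unique $v_j$ such that some $h\in H$ has $v_i\in h\subseteq[v_i,v_j]$ but no $h\in H$ has $v_i\in h\subseteq[v_i,v_{j-1}]$. -}

module Defs where

open import Data.Nat using (ℕ; zero; suc; _+_; _∸_; _≤_; _<_; NonZero)
open import Data.Nat.DivMod using (_%_; m%n<n)
open import Data.Fin using (Fin; toℕ; fromℕ<)
open import Data.Fin.Subset using (Subset; _∈_; ∣_∣)
open import Data.Bool using (Bool; true)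
open import Data.Product using (Σ; _×_; ∃; ∃-syntax)
open import Data.Sum using (_⊎_)
open import Data.Empty using (⊥)
open import Relation.Nullary using (¬_)
open import Relation.Binary.PropositionalEquality using (_≡_)

-- The points of Ω_n are v_0,…,v_{n-1}, represented by Fin n (v_i ↦ i).
-- Throughout, n is nonzero so that arithmetic modulo n makes sense.

module _ {n : ℕ} .{{_ : NonZero n}} where

  _⊕_ : Fin n → ℕ → Fin n
  i ⊕ k = fromℕ< (m%n<n (toℕ i + k) n)

  -- v_{i-k} (for k ≤ n), computed as v_{i+(n-k)}
  _⊖_ : Fin n → ℕ → Fin n
  i ⊖ k = i ⊕ (n ∸ k)

  -- clockwise distance from a to x: number of steps travelling clockwise from a to x
  dist : Fin n → Fin n → ℕ
  dist a x = (toℕ x + (n ∸ toℕ a)) % n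

  -- x ∈ [a,b] (clockwise closed interval; [a,a] = {a})
  InClosed : Fin n → Fin n → Fin n → Set
  InClosed a b x = dist a x ≤ dist a b

  -- x ∈ (a,b) (clockwise open interval; (a,a) = ∅)
  InOpen : Fin n → Fin n → Fin n → Set
  InOpen a b x = (0 < dist a x) × (dist a x < dist a b)

  ⊆Closed : Subset n → Fin n → Fin n → Set
  ⊆Closed h a b = ∀ x → x ∈ h → InClosed a b x

  ⊆Open : Subset n → Fin n → Fin n → Set
  ⊆Open h a b = ∀ x → x ∈ h → InOpen a b x

  Disjoint : Subset n → Subset n → Set
  Disjoint h₁ h₂ = ∀ x → x ∈ h₁ → x ∈ h₂ → ⊥

  CopyOrdered : Subset n → Subset n → Set
  CopyOrdered h₁ h₂ =
    Disjoint h₁ h₂ × ∃[ a ] ∃[ b ] (⊆Closed h₁ a b × ⊆Open h₂ b a)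

  -- the (unordered) pair {h₁,h₂} forms a copy of M_1^{(r)}
  FormsCopy : Subset n → Subset n → Set
  FormsCopy h₁ h₂ = CopyOrdered h₁ h₂ ⊎ CopyOrdered h₂ h₁

  -- A hypergraph on Ω_n is given by its (decidable) edge-indicator.
  Hypergraph : Set
  Hypergraph = Subset n → Bool

  Edge : Hypergraph → Subset n → Set
  Edge H e = H e ≡ true

  Saturated : ℕ → Hypergraph → Set
  Saturated r H =
    (∀ e → Edge H e → ∣ e ∣ ≡ r)
    × (∀ h₁ h₂ → Edge H h₁ → Edge H h₂ → ¬ FormsCopy h₁ h₂)
    × (∀ e → ∣ e ∣ ≡ r → ¬ Edge H e → ∃[ h ] (Edge H h × FormsCopy e h))

  IsLambda : Hypergraph → Fin n → Fin n → Set
  IsLambda H i j =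
    (∃[ h ] (Edge H h × i ∈ h × ⊆Closed h j i))
    × ¬ (∃[ h ] (Edge H h × i ∈ h × ⊆Closed h (j ⊕ 1) i))

  IsRho : Hypergraph → Fin n → Fin n → Set
  IsRho H i j =
    (∃[ h ] (Edge H h × i ∈ h × ⊆Closed h i j))
    × ¬ (∃[ h ] (Edge H h × i ∈ h × ⊆Closed h i (j ⊖ 1)))

  Cyc3 : Fin n → Fin n → Fin n → Set
  Cyc3 x y z = (0 < dist x y) × (dist x y < dist x z)

{-# OPTIONS --safe #-}
-- Measuring points by their clockwise distance from a base point turns arcs of Ω_n into
-- (possibly wrapping) intervals of ℕ, and two edges forming a copy of M_1^{(r)} can never
-- alternate in this order. The basic tool is a probe: r − 1 consecutive points from s plus one
-- further point x. If a probe is not an edge, saturation yields an edge disjoint from it, after its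
-- block and wholly on one side of x. Sliding x away from the block, an edge beyond one position and
-- an edge before the next would form a copy, so some probe is an edge, or an edge lies in the
-- first gap, or one lies beyond the last position. Since an edge needs r points, short gaps hold
-- none; this gives (1) and the distance bounds of (2). If ρ(v_i) came after λ(v_i), the edges
-- found between v_i and λ(v_i) and between ρ(v_i) and v_i would form a copy, which gives (3).
-- For (4), an edge forming a copy with e lies on one side of v_j, and then forms a copy with the
-- edge defining λ(v_i) or the one defining ρ(v_i).
module Submission where

open import Defs
open import Data.Nat
open import Data.Nat.Properties
open import Data.Nat.DivMod
open import Data.Nat.Solver using (module +-*-Solver)
open import Data.Fin using (Fin; toℕ; zero; suc)
open import Data.Fin.Properties using (toℕ<n; toℕ-fromℕ<; toℕ-injective; any?)
open import Data.Fin.Subset using (Subset; _∈_; _∉_; ∣_∣; ⁅_⁆; _∪_; inside; outside)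
  renaming (⊥ to ∅)
open import Data.Fin.Subset.Properties
  using (_∈?_; ∪-identityʳ; x∈p∪q⁻; x∈p∪q⁺; x∈⁅y⁆⇒x≡y; x∈⁅x⁆; p⊆q⇒∣p∣≤∣q∣; ∣⊥∣≡0; ∉⊥)
open import Data.Vec using (_∷_; here; there)
open import Data.Product
open import Data.Bool using (true)
open import Data.Bool.Properties using () renaming (_≟_ to _≟𝔹_)
open import Data.Sum
open import Data.Empty
open import Relation.Nullary
open import Relation.Nullary.Decidable using (_×-dec_)
open import Relation.Binary.PropositionalEquality
open import Function using (_∘_)

module _ {n : ℕ} .{{_ : NonZero n}} where

  open ≡-Reasoning

  %-absorbˡ : ∀ m k → (m % n + k) % n ≡ (m + k) % n
  %-absorbˡ m k = begin
    (m % n + k) % n            ≡⟨ %-distribˡ-+ (m % n) k n ⟩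
    (m % n % n + k % n) % n    ≡⟨ cong (λ t → (t + k % n) % n) (m%n%n≡m%n m n) ⟩
    (m % n + k % n) % n        ≡⟨ %-distribˡ-+ m k n ⟨
    (m + k) % n                ∎

  %-absorbʳ : ∀ k m → (k + m % n) % n ≡ (k + m) % n
  %-absorbʳ k m = begin
    (k + m % n) % n  ≡⟨ cong (_% n) (+-comm k (m % n)) ⟩
    (m % n + k) % n  ≡⟨ %-absorbˡ m k ⟩
    (m + k) % n      ≡⟨ cong (_% n) (+-comm m k) ⟩
    (k + m) % n      ∎

  m<n+n⇒m%n≡m⊎m%n+n≡m : ∀ m → m < n + n → m % n ≡ m ⊎ m % n + n ≡ m
  m<n+n⇒m%n≡m⊎m%n+n≡m m m<2n with m <? n
  ... | yes m<n = inj₁ (m<n⇒m%n≡m m<n)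
  ... | no m≮n = inj₂ (begin
    m % n + n        ≡⟨ cong (_+ n) (m≤n⇒[n∸m]%m≡n%m n≤m) ⟨
    (m ∸ n) % n + n  ≡⟨ cong (_+ n) (m<n⇒m%n≡m m∸n<n) ⟩
    m ∸ n + n        ≡⟨ m∸n+n≡m n≤m ⟩
    m                ∎)
    where
    n≤m : n ≤ m
    n≤m = ≮⇒≥ m≮n
    m∸n<n : m ∸ n < n
    m∸n<n = +-cancelʳ-< n (m ∸ n) n (subst (_< n + n) (sym (m∸n+n≡m n≤m)) m<2n)

  toℕ-⊕ : ∀ (a : Fin n) k → toℕ (a ⊕ k) ≡ (toℕ a + k) % n
  toℕ-⊕ a k = toℕ-fromℕ< (m%n<n (toℕ a + k) n)

  ⊕-⊕ : ∀ (a : Fin n) j k → (a ⊕ j) ⊕ k ≡ a ⊕ (j + k)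
  ⊕-⊕ a j k = toℕ-injective (begin
    toℕ ((a ⊕ j) ⊕ k)        ≡⟨ toℕ-⊕ (a ⊕ j) k ⟩
    (toℕ (a ⊕ j) + k) % n    ≡⟨ cong (λ t → (t + k) % n) (toℕ-⊕ a j) ⟩
    ((toℕ a + j) % n + k) % n ≡⟨ %-absorbˡ (toℕ a + j) k ⟩
    (toℕ a + j + k) % n      ≡⟨ cong (_% n) (+-assoc (toℕ a) j k) ⟩
    (toℕ a + (j + k)) % n    ≡⟨ toℕ-⊕ a (j + k) ⟨
    toℕ (a ⊕ (j + k))        ∎)

  ⊕-n : ∀ (a : Fin n) → a ⊕ n ≡ a
  ⊕-n a = toℕ-injective (begin
    toℕ (a ⊕ n)      ≡⟨ toℕ-⊕ a n ⟩
    (toℕ a + n) % n  ≡⟨ [m+n]%n≡m%n (toℕ a) n ⟩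
    toℕ a % n        ≡⟨ m<n⇒m%n≡m (toℕ<n a) ⟩
    toℕ a            ∎)

  +-offset : ∀ (a : Fin n) k → toℕ a + k + (n ∸ toℕ a) ≡ k + n
  +-offset a k = begin
    toℕ a + k + (n ∸ toℕ a)    ≡⟨ cong (_+ (n ∸ toℕ a)) (+-comm (toℕ a) k) ⟩
    k + toℕ a + (n ∸ toℕ a)    ≡⟨ +-assoc k (toℕ a) (n ∸ toℕ a) ⟩
    k + (toℕ a + (n ∸ toℕ a))  ≡⟨ cong (k +_) (m+[n∸m]≡n (<⇒≤ (toℕ<n a))) ⟩
    k + n                      ∎

  dist<n : ∀ (a y : Fin n) → dist a y < n
  dist<n a y = m%n<n _ n

  dist-⊕ : ∀ (a : Fin n) k → dist a (a ⊕ k) ≡ k % n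
  dist-⊕ a k = begin
    (toℕ (a ⊕ k) + (n ∸ toℕ a)) % n       ≡⟨ cong (λ t → (t + (n ∸ toℕ a)) % n) (toℕ-⊕ a k) ⟩
    ((toℕ a + k) % n + (n ∸ toℕ a)) % n   ≡⟨ %-absorbˡ (toℕ a + k) (n ∸ toℕ a) ⟩
    (toℕ a + k + (n ∸ toℕ a)) % n         ≡⟨ cong (_% n) (+-offset a k) ⟩
    (k + n) % n                           ≡⟨ [m+n]%n≡m%n k n ⟩
    k % n                                 ∎

  dist-⊕-< : ∀ (a : Fin n) {k} → k < n → dist a (a ⊕ k) ≡ k
  dist-⊕-< a {k} k<n = trans (dist-⊕ a k) (m<n⇒m%n≡m k<n)

  ⊕-dist : ∀ (a y : Fin n) → a ⊕ dist a y ≡ y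
  ⊕-dist a y = toℕ-injective (begin
    toℕ (a ⊕ dist a y)                      ≡⟨ toℕ-⊕ a (dist a y) ⟩
    (toℕ a + (toℕ y + (n ∸ toℕ a)) % n) % n ≡⟨ %-absorbʳ (toℕ a) (toℕ y + (n ∸ toℕ a)) ⟩
    (toℕ a + (toℕ y + (n ∸ toℕ a))) % n     ≡⟨ cong (_% n) (+-assoc (toℕ a) (toℕ y) _) ⟨
    (toℕ a + toℕ y + (n ∸ toℕ a)) % n       ≡⟨ cong (_% n) (+-offset a (toℕ y)) ⟩
    (toℕ y + n) % n                         ≡⟨ [m+n]%n≡m%n (toℕ y) n ⟩
    toℕ y % n                               ≡⟨ m<n⇒m%n≡m (toℕ<n y) ⟩
    toℕ y                                   ∎)

  dist-self : ∀ (a : Fin n) → dist a a ≡ 0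
  dist-self a = begin
    (toℕ a + (n ∸ toℕ a)) % n  ≡⟨ cong (_% n) (m+[n∸m]≡n (<⇒≤ (toℕ<n a))) ⟩
    n % n                      ≡⟨ n%n≡0 n ⟩
    0                          ∎

  dist-injective : ∀ (c : Fin n) {y z} → dist c y ≡ dist c z → y ≡ z
  dist-injective c {y} {z} eq = begin
    y               ≡⟨ ⊕-dist c y ⟨
    c ⊕ dist c y    ≡⟨ cong (c ⊕_) eq ⟩
    c ⊕ dist c z    ≡⟨ ⊕-dist c z ⟩
    z               ∎

  dist≡0⇒≡ : ∀ {a y : Fin n} → dist a y ≡ 0 → a ≡ y
  dist≡0⇒≡ {a} eq = dist-injective a (trans (dist-self a) (sym eq))

  dist-cocycle : ∀ (c a y : Fin n) → dist c y ≡ (dist c a + dist a y) % n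
  dist-cocycle c a y = begin
    dist c y                              ≡⟨ cong (dist c) path ⟨
    dist c (c ⊕ (dist c a + dist a y))    ≡⟨ dist-⊕ c _ ⟩
    (dist c a + dist a y) % n             ∎
    where
    path : c ⊕ (dist c a + dist a y) ≡ y
    path = begin
      c ⊕ (dist c a + dist a y)    ≡⟨ ⊕-⊕ c (dist c a) (dist a y) ⟨
      (c ⊕ dist c a) ⊕ dist a y    ≡⟨ cong (_⊕ dist a y) (⊕-dist c a) ⟩
      a ⊕ dist a y                 ≡⟨ ⊕-dist a y ⟩
      y                            ∎

  dist-+-cases : ∀ (c a y : Fin n) →
    dist c a + dist a y ≡ dist c y ⊎ dist c a + dist a y ≡ dist c y + n
  dist-+-cases c a y
    with m<n+n⇒m%n≡m⊎m%n+n≡m (dist c a + dist a y) (+-mono-< (dist<n c a) (dist<n a y))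
  ... | inj₁ eq = inj₁ (trans (sym eq) (sym (dist-cocycle c a y)))
  ... | inj₂ eq = inj₂ (trans (sym eq) (cong (_+ n) (sym (dist-cocycle c a y))))

  dist-+ : ∀ (c a y : Fin n) → dist c a ≤ dist c y → dist c a + dist a y ≡ dist c y
  dist-+ c a y A≤Y with dist-+-cases c a y
  ... | inj₁ eq = eq
  ... | inj₂ eq = contradiction (≤-trans (+-monoˡ-≤ n A≤Y) (≤-reflexive (sym eq)))
                     (<⇒≱ (+-monoʳ-< (dist c a) (dist<n a y)))

  dist-+-wrap : ∀ (c a y : Fin n) → dist c y < dist c a → dist c a + dist a y ≡ dist c y + n
  dist-+-wrap c a y Y<A with dist-+-cases c a y
  ... | inj₂ eq = eq
  ... | inj₁ eq = contradiction (≤-trans (m≤m+n (dist c a) (dist a y)) (≤-reflexive eq)) (<⇒≱ Y<A)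

  dist-+-< : ∀ (c a y : Fin n) → dist c a + dist a y < n → dist c a + dist a y ≡ dist c y
  dist-+-< c a y lt with dist-+-cases c a y
  ... | inj₁ eq = eq
  ... | inj₂ eq = contradiction (≤-trans (m≤n+m n (dist c y)) (≤-reflexive (sym eq))) (<⇒≱ lt)

  dist+dist≡n : ∀ (a b : Fin n) → a ≢ b → dist a b + dist b a ≡ n
  dist+dist≡n a b a≢b with dist-+-cases a b a
  ... | inj₂ eq = trans eq (cong (_+ n) (dist-self a))
  ... | inj₁ eq = contradiction (dist≡0⇒≡ (m+n≡0⇒m≡0 (dist a b) (trans eq (dist-self a)))) a≢b

  dist-shift : ∀ (c a : Fin n) k → dist c a + k < n → dist c (a ⊕ k) ≡ dist c a + k
  dist-shift c a k lt = begin
    dist c (a ⊕ k)               ≡⟨ cong (λ t → dist c (t ⊕ k)) (⊕-dist c a) ⟨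
    dist c ((c ⊕ dist c a) ⊕ k)  ≡⟨ cong (dist c) (⊕-⊕ c (dist c a) k) ⟩
    dist c (c ⊕ (dist c a + k))  ≡⟨ dist-⊕-< c lt ⟩
    dist c a + k                 ∎

  dist-⊖ : ∀ (i : Fin n) {k} → k < n → dist (i ⊖ k) i ≡ k
  dist-⊖ i {k} k<n = begin
    dist (i ⊖ k) i               ≡⟨ cong (dist (i ⊖ k)) back ⟨
    dist (i ⊖ k) ((i ⊖ k) ⊕ k)   ≡⟨ dist-⊕-< (i ⊖ k) k<n ⟩
    k                            ∎
    where
    back : (i ⊖ k) ⊕ k ≡ i
    back = begin
      (i ⊕ (n ∸ k)) ⊕ k   ≡⟨ ⊕-⊕ i (n ∸ k) k ⟩
      i ⊕ (n ∸ k + k)     ≡⟨ cong (i ⊕_) (m∸n+n≡m (<⇒≤ k<n)) ⟩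
      i ⊕ n               ≡⟨ ⊕-n i ⟩
      i                   ∎

  dist-⊖1 : ∀ (c a : Fin n) → 0 < dist c a → suc (dist c (a ⊖ 1)) ≡ dist c a
  dist-⊖1 c a 0<A with dist c a in eq
  ... | suc d = cong suc (begin
    dist c (a ⊕ (n ∸ 1))                ≡⟨ cong (λ t → dist c (t ⊕ (n ∸ 1))) (⊕-dist c a) ⟨
    dist c ((c ⊕ dist c a) ⊕ (n ∸ 1))   ≡⟨ cong (dist c) (⊕-⊕ c (dist c a) (n ∸ 1)) ⟩
    dist c (c ⊕ (dist c a + (n ∸ 1)))   ≡⟨ dist-⊕ c _ ⟩
    (dist c a + (n ∸ 1)) % n            ≡⟨ cong (_% n) unwind ⟩
    (d + n) % n                         ≡⟨ [m+n]%n≡m%n d n ⟩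
    d % n                               ≡⟨ m<n⇒m%n≡m d<n ⟩
    d                                   ∎)
    where
    d<n : d < n
    d<n = <-trans (n<1+n d) (subst (_< n) eq (dist<n c a))
    unwind : dist c a + (n ∸ 1) ≡ d + n
    unwind = begin
      dist c a + (n ∸ 1)    ≡⟨ cong (_+ (n ∸ 1)) eq ⟩
      suc d + (n ∸ 1)       ≡⟨ +-suc d (n ∸ 1) ⟨
      d + suc (n ∸ 1)       ≡⟨ cong (d +_) (m+[n∸m]≡n (≤-trans (s≤s z≤n) d<n)) ⟩
      d + n                 ∎

module _ {n : ℕ} .{{_ : NonZero n}} where

  0<dist⇒≢ : ∀ {a b : Fin n} → 0 < dist a b → a ≢ b
  0<dist⇒≢ {a} 0<D refl = <⇒≢ 0<D (sym (dist-self a))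

  dist-⊖-+ : ∀ (i : Fin n) {k} y → k < n → k ≤ dist (i ⊖ k) y → k + dist i y ≡ dist (i ⊖ k) y
  dist-⊖-+ i {k} y k<n k≤ =
    trans (cong (_+ dist i y) (sym S-i)) (dist-+ (i ⊖ k) i y (subst (_≤ dist (i ⊖ k) y) (sym S-i) k≤))
    where
    S-i : dist (i ⊖ k) i ≡ k
    S-i = dist-⊖ i k<n

  dist-⊖-+-< : ∀ (i : Fin n) {k} y → k + dist i y < n → k + dist i y ≡ dist (i ⊖ k) y
  dist-⊖-+-< i {k} y lt =
    trans (cong (_+ dist i y) (sym S-i))
          (dist-+-< (i ⊖ k) i y (subst (λ t → t + dist i y < n) (sym S-i) lt))
    where
    S-i : dist (i ⊖ k) i ≡ k
    S-i = dist-⊖ i (≤-<-trans (m≤m+n k (dist i y)) lt)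

  ∈window : ∀ (i : Fin n) a b {y} → a + b < n →
    InClosed (i ⊖ a) (i ⊕ b) y → dist y i ≤ a ⊎ dist i y ≤ b
  ∈window i a b {y} a+b<n y∈window with dist (i ⊖ a) y ≤? a
  ... | yes S≤a = inj₁ (≤-trans (m≤n+m (dist y i) (dist s y))
                          (≤-reflexive (trans (dist-+ s y i (subst (dist s y ≤_) (sym S-i) S≤a)) S-i)))
    where
    s = i ⊖ a
    S-i : dist s i ≡ a
    S-i = dist-⊖ i (≤-<-trans (m≤m+n a b) a+b<n)
  ... | no S≰a = inj₂ (+-cancelˡ-≤ a _ _ (begin
    a + dist i y          ≡⟨ dist-⊖-+ i y a<n (<⇒≤ (≰⇒> S≰a)) ⟩
    dist (i ⊖ a) y        ≤⟨ y∈window ⟩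
    dist (i ⊖ a) (i ⊕ b)  ≡⟨ dist-⊖-+-< i (i ⊕ b) (subst (λ t → a + t < n) (sym B) a+b<n) ⟨
    a + dist i (i ⊕ b)    ≡⟨ cong (a +_) B ⟩
    a + b                 ∎))
    where
    open ≤-Reasoning
    a<n : a < n
    a<n = ≤-<-trans (m≤m+n a b) a+b<n
    B : dist i (i ⊕ b) ≡ b
    B = dist-⊕-< i (≤-<-trans (m≤n+m b a) a+b<n)

-- y on the arc from a to b, in distances A, B, Y from a base point; the arc wraps past the
-- base point exactly when B < A.
ArcCoords : (ℕ → ℕ → Set) → ℕ → ℕ → ℕ → Set
ArcCoords _≺_ A B Y = (A ≺ Y × Y ≺ B) ⊎ (B < A × A ≺ Y) ⊎ (Y ≺ B × B < A)

module _ {n : ℕ} .{{_ : NonZero n}} (c a b y : Fin n) where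

  private
    A = dist c a
    B = dist c b
    Y = dist c y

  InClosed⇒ArcCoords : InClosed a b y → ArcCoords _≤_ A B Y
  InClosed⇒ArcCoords y≤b with A ≤? Y | A ≤? B
  ... | yes A≤Y | yes A≤B =
        inj₁ (A≤Y , subst₂ _≤_ (dist-+ c a y A≤Y) (dist-+ c a b A≤B) (+-monoʳ-≤ A y≤b))
  ... | yes A≤Y | no A≰B = inj₂ (inj₁ (≰⇒> A≰B , A≤Y))
  ... | no A≰Y | yes A≤B = contradiction
        (subst₂ _≤_ (dist-+-wrap c a y (≰⇒> A≰Y)) (dist-+ c a b A≤B) (+-monoʳ-≤ A y≤b))
        (<⇒≱ (<-≤-trans (dist<n c b) (m≤n+m n Y)))
  ... | no A≰Y | no A≰B = inj₂ (inj₂ (+-cancelʳ-≤ n Y B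
        (subst₂ _≤_ (dist-+-wrap c a y (≰⇒> A≰Y)) (dist-+-wrap c a b (≰⇒> A≰B)) (+-monoʳ-≤ A y≤b))
        , ≰⇒> A≰B))

  ArcCoords⇒InClosed : ArcCoords _≤_ A B Y → InClosed a b y
  ArcCoords⇒InClosed (inj₁ (A≤Y , Y≤B)) = +-cancelˡ-≤ A _ _
    (subst₂ _≤_ (sym (dist-+ c a y A≤Y)) (sym (dist-+ c a b (≤-trans A≤Y Y≤B))) Y≤B)
  ArcCoords⇒InClosed (inj₂ (inj₁ (B<A , A≤Y))) = +-cancelˡ-≤ A _ _
    (subst₂ _≤_ (sym (dist-+ c a y A≤Y)) (sym (dist-+-wrap c a b B<A))
                (≤-trans (<⇒≤ (dist<n c y)) (m≤n+m n B)))
  ArcCoords⇒InClosed (inj₂ (inj₂ (Y≤B , B<A))) = +-cancelˡ-≤ A _ _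
    (subst₂ _≤_ (sym (dist-+-wrap c a y (≤-<-trans Y≤B B<A))) (sym (dist-+-wrap c a b B<A))
                (+-monoˡ-≤ n Y≤B))

  InOpen⇒ArcCoords : InOpen a b y → ArcCoords _<_ A B Y
  InOpen⇒ArcCoords (0<y , y<b) with A ≤? Y | A ≤? B
  ... | yes A≤Y | yes A≤B = inj₁ (subst (A <_) (dist-+ c a y A≤Y) (m<m+n A 0<y) ,
        subst₂ _<_ (dist-+ c a y A≤Y) (dist-+ c a b A≤B) (+-monoʳ-< A y<b))
  ... | yes A≤Y | no A≰B = inj₂ (inj₁ (≰⇒> A≰B , subst (A <_) (dist-+ c a y A≤Y) (m<m+n A 0<y)))
  ... | no A≰Y | yes A≤B = contradiction
        (subst₂ _<_ (dist-+-wrap c a y (≰⇒> A≰Y)) (dist-+ c a b A≤B) (+-monoʳ-< A y<b))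
        (<-asym (<-≤-trans (dist<n c b) (m≤n+m n Y)))
  ... | no A≰Y | no A≰B = inj₂ (inj₂ (+-cancelʳ-< n Y B
        (subst₂ _<_ (dist-+-wrap c a y (≰⇒> A≰Y)) (dist-+-wrap c a b (≰⇒> A≰B)) (+-monoʳ-< A y<b))
        , ≰⇒> A≰B))

  ArcCoords⇒InOpen : ArcCoords _<_ A B Y → InOpen a b y
  ArcCoords⇒InOpen coords = n≢0⇒n>0 (A≢Y coords ∘ cong (dist c) ∘ dist≡0⇒≡) , lt coords
    where
    A≢Y : ArcCoords _<_ A B Y → A ≢ Y
    A≢Y (inj₁ (A<Y , _)) = <⇒≢ A<Y
    A≢Y (inj₂ (inj₁ (_ , A<Y))) = <⇒≢ A<Y
    A≢Y (inj₂ (inj₂ (Y<B , B<A))) = ≢-sym (<⇒≢ (<-trans Y<B B<A))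
    lt : ArcCoords _<_ A B Y → dist a y < dist a b
    lt (inj₁ (A<Y , Y<B)) = +-cancelˡ-< A _ _
      (subst₂ _<_ (sym (dist-+ c a y (<⇒≤ A<Y))) (sym (dist-+ c a b (<⇒≤ (<-trans A<Y Y<B)))) Y<B)
    lt (inj₂ (inj₁ (B<A , A<Y))) = +-cancelˡ-< A _ _
      (subst₂ _<_ (sym (dist-+ c a y (<⇒≤ A<Y))) (sym (dist-+-wrap c a b B<A))
                  (<-≤-trans (dist<n c y) (m≤n+m n B)))
    lt (inj₂ (inj₂ (Y<B , B<A))) = +-cancelˡ-< A _ _
      (subst₂ _<_ (sym (dist-+-wrap c a y (<-trans Y<B B<A))) (sym (dist-+-wrap c a b B<A))
                  (+-monoˡ-< n Y<B))

module _ {n : ℕ} .{{_ : NonZero n}} (c : Fin n) {a b y : Fin n} where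

  closed-straight : dist c a ≤ dist c b → InClosed a b y → dist c a ≤ dist c y × dist c y ≤ dist c b
  closed-straight A≤B y∈ab with InClosed⇒ArcCoords c a b y y∈ab
  ... | inj₁ A≤Y≤B = A≤Y≤B
  ... | inj₂ (inj₁ (B<A , _)) = contradiction A≤B (<⇒≱ B<A)
  ... | inj₂ (inj₂ (_ , B<A)) = contradiction A≤B (<⇒≱ B<A)

  closed-wrapped : dist c b < dist c a → InClosed a b y → dist c a ≤ dist c y ⊎ dist c y ≤ dist c b
  closed-wrapped B<A y∈ab with InClosed⇒ArcCoords c a b y y∈ab
  ... | inj₁ (A≤Y , _) = inj₁ A≤Y
  ... | inj₂ (inj₁ (_ , A≤Y)) = inj₁ A≤Y
  ... | inj₂ (inj₂ (Y≤B , _)) = inj₂ Y≤B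

  open-straight : dist c a ≤ dist c b → InOpen b a y → dist c b < dist c y ⊎ dist c y < dist c a
  open-straight A≤B y∈ba with InOpen⇒ArcCoords c b a y y∈ba
  ... | inj₁ (B<Y , Y<A) = contradiction A≤B (<⇒≱ (<-trans B<Y Y<A))
  ... | inj₂ (inj₁ (_ , B<Y)) = inj₁ B<Y
  ... | inj₂ (inj₂ (Y<A , _)) = inj₂ Y<A

  open-wrapped : dist c b < dist c a → InOpen b a y → dist c b < dist c y × dist c y < dist c a
  open-wrapped B<A y∈ba with InOpen⇒ArcCoords c b a y y∈ba
  ... | inj₁ B<Y<A = B<Y<A
  ... | inj₂ (inj₁ (A<B , _)) = contradiction B<A (<-asym A<B)
  ... | inj₂ (inj₂ (_ , A<B)) = contradiction B<A (<-asym A<B)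

copy-disjoint : ∀ {n} .{{_ : NonZero n}} {h₁ h₂ : Subset n} → FormsCopy h₁ h₂ → Disjoint h₁ h₂
copy-disjoint (inj₁ (h₁∩h₂≡∅ , _)) = h₁∩h₂≡∅
copy-disjoint (inj₂ (h₂∩h₁≡∅ , _)) y m₁ m₂ = h₂∩h₁≡∅ y m₂ m₁

module _ {n : ℕ} .{{_ : NonZero n}} (c : Fin n) where

  closed-open-¬alternating : ∀ {a b p₁ p₂ p₃ p₄ : Fin n} →
    InClosed a b p₁ → InOpen b a p₂ → InClosed a b p₃ → InOpen b a p₄ →
    dist c p₁ < dist c p₂ → dist c p₂ < dist c p₃ → dist c p₃ < dist c p₄ → ⊥
  closed-open-¬alternating {a} {b} h₁ h₂ h₃ h₄ l₁₂ l₂₃ l₃₄ with dist c a ≤? dist c b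
  ... | yes A≤B with open-straight c A≤B h₂
  ...   | inj₁ B<P₂ = <⇒≱ (<-trans B<P₂ l₂₃) (proj₂ (closed-straight c A≤B h₃))
  ...   | inj₂ P₂<A = <⇒≱ (<-trans l₁₂ P₂<A) (proj₁ (closed-straight c A≤B h₁))
  closed-open-¬alternating h₁ h₂ h₃ h₄ l₁₂ l₂₃ l₃₄ | no A≰B with closed-wrapped c (≰⇒> A≰B) h₃
  ...   | inj₁ A≤P₃ = <⇒≱ (proj₂ (open-wrapped c (≰⇒> A≰B) h₄)) (≤-trans A≤P₃ (<⇒≤ l₃₄))
  ...   | inj₂ P₃≤B = <⇒≱ (proj₁ (open-wrapped c (≰⇒> A≰B) h₂)) (≤-trans (<⇒≤ l₂₃) P₃≤B)

  open-closed-¬alternating : ∀ {a b p₁ p₂ p₃ p₄ : Fin n} →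
    InOpen b a p₁ → InClosed a b p₂ → InOpen b a p₃ → InClosed a b p₄ →
    dist c p₁ < dist c p₂ → dist c p₂ < dist c p₃ → dist c p₃ < dist c p₄ → ⊥
  open-closed-¬alternating {a} {b} h₁ h₂ h₃ h₄ l₁₂ l₂₃ l₃₄ with dist c a ≤? dist c b
  ... | yes A≤B with open-straight c A≤B h₃
  ...   | inj₁ B<P₃ = <⇒≱ (<-trans B<P₃ l₃₄) (proj₂ (closed-straight c A≤B h₄))
  ...   | inj₂ P₃<A = <⇒≱ (<-trans l₂₃ P₃<A) (proj₁ (closed-straight c A≤B h₂))
  open-closed-¬alternating h₁ h₂ h₃ h₄ l₁₂ l₂₃ l₃₄ | no A≰B with closed-wrapped c (≰⇒> A≰B) h₂
  ...   | inj₁ A≤P₂ = <⇒≱ (proj₂ (open-wrapped c (≰⇒> A≰B) h₃)) (≤-trans A≤P₂ (<⇒≤ l₂₃))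
  ...   | inj₂ P₂≤B = <⇒≱ (proj₁ (open-wrapped c (≰⇒> A≰B) h₁)) (≤-trans (<⇒≤ l₁₂) P₂≤B)

  copy-¬alternating : ∀ {h₁ h₂} → FormsCopy h₁ h₂ → ∀ {p₁ p₂ p₃ p₄} →
    p₁ ∈ h₁ → p₂ ∈ h₂ → p₃ ∈ h₁ → p₄ ∈ h₂ →
    dist c p₁ < dist c p₂ → dist c p₂ < dist c p₃ → dist c p₃ < dist c p₄ → ⊥
  copy-¬alternating (inj₁ (_ , a , b , h₁⊆ , h₂⊆)) m₁ m₂ m₃ m₄ =
    closed-open-¬alternating {a} {b} (h₁⊆ _ m₁) (h₂⊆ _ m₂) (h₁⊆ _ m₃) (h₂⊆ _ m₄)
  copy-¬alternating (inj₂ (_ , a , b , h₂⊆ , h₁⊆)) m₁ m₂ m₃ m₄ =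
    open-closed-¬alternating {a} {b} (h₁⊆ _ m₁) (h₂⊆ _ m₂) (h₁⊆ _ m₃) (h₂⊆ _ m₄)


  copy-dist-≢ : ∀ {h g : Subset n} {b y} → FormsCopy h g → b ∈ h → y ∈ g → dist c b ≢ dist c y
  copy-dist-≢ copy b∈h y∈g eq = copy-disjoint copy _ b∈h (subst (_∈ _) (sym (dist-injective c eq)) y∈g)

  copy-one-side : ∀ {h g : Subset n} {a b} → FormsCopy h g → a ∈ h → b ∈ h → dist c a < dist c b →
    (∀ y → y ∈ g → dist c a < dist c y) →
    (∀ y → y ∈ g → dist c y < dist c b) ⊎ (∀ y → y ∈ g → dist c b < dist c y)
  copy-one-side {h} {g} {a} {b} copy a∈h b∈h A<B beyond-a
    with any? (λ y → (y ∈? g) ×-dec (dist c y <? dist c b))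
  ... | yes (y₁ , y₁∈g , Y₁<B) = inj₁ below
    where
    below : ∀ y → y ∈ g → dist c y < dist c b
    below y y∈g with dist c y <? dist c b
    ... | yes Y<B = Y<B
    ... | no Y≮B = ⊥-elim (copy-¬alternating copy a∈h y₁∈g b∈h y∈g (beyond-a y₁ y₁∈g) Y₁<B
                     (≤∧≢⇒< (≮⇒≥ Y≮B) (copy-dist-≢ copy b∈h y∈g)))
  ... | no none-below = inj₂ λ y y∈g →
    ≤∧≢⇒< (≮⇒≥ (λ Y<B → none-below (y , y∈g , Y<B))) (copy-dist-≢ copy b∈h y∈g)

  separated⇒copy : ∀ {u v} {g₁ g₂ : Subset n} → u < v → v < n →
    (∀ y → y ∈ g₁ → u ≤ dist c y × dist c y ≤ v) → (∀ y → y ∈ g₂ → v < dist c y) → CopyOrdered g₁ g₂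
  separated⇒copy {u} {v} u<v v<n g₁-between g₂-beyond =
      (λ y y∈g₁ y∈g₂ → <⇒≱ (g₂-beyond y y∈g₂) (proj₂ (g₁-between y y∈g₁)))
    , c ⊕ u , c ⊕ v
    , (λ y y∈g₁ → ArcCoords⇒InClosed c (c ⊕ u) (c ⊕ v) y (inj₁
        ( subst (_≤ dist c y) (sym U) (proj₁ (g₁-between y y∈g₁))
        , subst (dist c y ≤_) (sym V) (proj₂ (g₁-between y y∈g₁)))))
    , (λ y y∈g₂ → ArcCoords⇒InOpen c (c ⊕ v) (c ⊕ u) y (inj₂ (inj₁
        ( subst₂ _<_ (sym U) (sym V) u<v
        , subst (_< dist c y) (sym V) (g₂-beyond y y∈g₂)))))
    where
    U : dist c (c ⊕ u) ≡ u
    U = dist-⊕-< c (<-trans u<v v<n)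
    V : dist c (c ⊕ v) ≡ v
    V = dist-⊕-< c v<n

∣p∪⁅x⁆∣≡1+∣p∣ : ∀ {m} (p : Subset m) x → x ∉ p → ∣ p ∪ ⁅ x ⁆ ∣ ≡ suc ∣ p ∣
∣p∪⁅x⁆∣≡1+∣p∣ (outside ∷ p) zero x∉p rewrite ∪-identityʳ p = refl
∣p∪⁅x⁆∣≡1+∣p∣ (inside ∷ p) zero x∉p = contradiction here x∉p
∣p∪⁅x⁆∣≡1+∣p∣ (outside ∷ p) (suc x) x∉p = ∣p∪⁅x⁆∣≡1+∣p∣ p x (x∉p ∘ there)
∣p∪⁅x⁆∣≡1+∣p∣ (inside ∷ p) (suc x) x∉p = cong suc (∣p∪⁅x⁆∣≡1+∣p∣ p x (x∉p ∘ there))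

module _ {n : ℕ} .{{_ : NonZero n}} where

  segment : Fin n → ℕ → Subset n
  segment c zero = ∅
  segment c (suc m) = segment c m ∪ ⁅ c ⊕ m ⁆

  ∈segment⁻ : ∀ c m {y} → y ∈ segment c m → dist c y < m
  ∈segment⁻ c zero y∈∅ = contradiction y∈∅ ∉⊥
  ∈segment⁻ c (suc m) {y} y∈ with x∈p∪q⁻ (segment c m) ⁅ c ⊕ m ⁆ y∈
  ... | inj₁ y∈segment = m≤n⇒m≤1+n (∈segment⁻ c m y∈segment)
  ... | inj₂ y∈⁅c⊕m⁆ with x∈⁅y⁆⇒x≡y (c ⊕ m) y∈⁅c⊕m⁆ | m <? n
  ...   | refl | yes m<n = s≤s (≤-reflexive (dist-⊕-< c m<n))
  ...   | refl | no m≮n = m≤n⇒m≤1+n (≤-trans (dist<n c (c ⊕ m)) (≮⇒≥ m≮n))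

  ∈segment⁺ : ∀ c m {y} → dist c y < m → y ∈ segment c m
  ∈segment⁺ c (suc m) {y} Y<1+m with m≤n⇒m<n∨m≡n (s≤s⁻¹ Y<1+m)
  ... | inj₁ Y<m = x∈p∪q⁺ (inj₁ (∈segment⁺ c m Y<m))
  ... | inj₂ Y≡m = x∈p∪q⁺ (inj₂ (subst (_∈ ⁅ c ⊕ m ⁆) y≡c⊕m (x∈⁅x⁆ (c ⊕ m))))
    where
    y≡c⊕m : c ⊕ m ≡ y
    y≡c⊕m = dist-injective c (trans (dist-⊕-< c (subst (_< n) Y≡m (dist<n c y))) (sym Y≡m))

  ∣segment∣ : ∀ c m → m ≤ n → ∣ segment c m ∣ ≡ m
  ∣segment∣ c zero _ = ∣⊥∣≡0 n
  ∣segment∣ c (suc m) 1+m≤n = begin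
    ∣ segment c m ∪ ⁅ c ⊕ m ⁆ ∣  ≡⟨ ∣p∪⁅x⁆∣≡1+∣p∣ (segment c m) (c ⊕ m) c⊕m∉ ⟩
    suc ∣ segment c m ∣          ≡⟨ cong suc (∣segment∣ c m (<⇒≤ 1+m≤n)) ⟩
    suc m                        ∎
    where
    open ≡-Reasoning
    c⊕m∉ : c ⊕ m ∉ segment c m
    c⊕m∉ c⊕m∈ = <-irrefl (dist-⊕-< c 1+m≤n) (∈segment⁻ c m c⊕m∈)

  ∣p∣≤span : ∀ c m {g : Subset n} → m ≤ n → (∀ y → y ∈ g → dist c y < m) → ∣ g ∣ ≤ m
  ∣p∣≤span c m {g} m≤n g-within = begin
    ∣ g ∣            ≤⟨ p⊆q⇒∣p∣≤∣q∣ (λ {y} y∈g → ∈segment⁺ c m (g-within y y∈g)) ⟩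
    ∣ segment c m ∣  ≡⟨ ∣segment∣ c m m≤n ⟩
    m                ∎
    where open ≤-Reasoning

  probe : Fin n → ℕ → Fin n → Subset n
  probe c m x = segment c (suc m) ∪ ⁅ x ⁆

  ∈probe⁻ : ∀ c m x {y} → y ∈ probe c m x → dist c y ≤ m ⊎ y ≡ x
  ∈probe⁻ c m x y∈ with x∈p∪q⁻ (segment c (suc m)) ⁅ x ⁆ y∈
  ... | inj₁ y∈segment = inj₁ (s≤s⁻¹ (∈segment⁻ c (suc m) y∈segment))
  ... | inj₂ y∈⁅x⁆ = inj₂ (x∈⁅y⁆⇒x≡y x y∈⁅x⁆)

  ∈probe-segment : ∀ c m x {y} → dist c y ≤ m → y ∈ probe c m x
  ∈probe-segment c m x Y≤m = x∈p∪q⁺ (inj₁ (∈segment⁺ c (suc m) (s≤s Y≤m)))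

  ∈probe-extra : ∀ c m x → x ∈ probe c m x
  ∈probe-extra c m x = x∈p∪q⁺ (inj₂ (x∈⁅x⁆ x))

  ∣probe∣ : ∀ c m x → suc m ≤ n → m < dist c x → ∣ probe c m x ∣ ≡ suc (suc m)
  ∣probe∣ c m x 1+m≤n m<X =
    trans (∣p∪⁅x⁆∣≡1+∣p∣ (segment c (suc m)) x x∉) (cong suc (∣segment∣ c (suc m) 1+m≤n))
    where
    x∉ : x ∉ segment c (suc m)
    x∉ x∈ = <⇒≱ m<X (s≤s⁻¹ (∈segment⁻ c (suc m) x∈))

-- M = r − 2: a probe consists of a block of r − 1 points and one further point.
module SaturatedHypergraph {n : ℕ} .{{_ : NonZero n}} (M : ℕ) (large : 2 * suc (suc M) ≤ n)
  (H : Hypergraph {n})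
  (edge-size : ∀ e → Edge H e → ∣ e ∣ ≡ suc (suc M))
  (no-copy : ∀ h₁ h₂ → Edge H h₁ → Edge H h₂ → ¬ FormsCopy h₁ h₂)
  (completes-copy : ∀ e → ∣ e ∣ ≡ suc (suc M) → ¬ Edge H e → ∃[ h ] (Edge H h × FormsCopy e h)) where

  private
    o : ℕ
    o = proj₁ (m≤n⇒∃[o]m+o≡n large)

    n≡ : 2 * suc (suc M) + o ≡ n
    n≡ = proj₂ (m≤n⇒∃[o]m+o≡n large)

  Edge? : ∀ e → Dec (Edge H e)
  Edge? e = H e ≟𝔹 true

  edge-span : ∀ c m {g} → Edge H g → (∀ y → y ∈ g → dist c y < m) → suc (suc M) ≤ m
  edge-span c m {g} eg g-within with m ≤? n
  ... | yes m≤n = subst (_≤ m) (edge-size g eg) (∣p∣≤span c m m≤n g-within)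
  ... | no m≰n = ≤-trans (≤-trans (m≤m+n (suc (suc M)) _) large) (<⇒≤ (≰⇒> m≰n))

  edge-span-from : ∀ c u w {g} → u < n → Edge H g →
    (∀ y → y ∈ g → u ≤ dist c y × dist c y < u + w) → suc (suc M) ≤ w
  edge-span-from c u w u<n eg g-within = edge-span (c ⊕ u) w eg λ y y∈g →
    let (u≤Y , Y<u+w) = g-within y y∈g in
    +-cancelˡ-< u _ w (subst (_< u + w) (sym (shifted y u≤Y)) Y<u+w)
    where
    U : dist c (c ⊕ u) ≡ u
    U = dist-⊕-< c u<n
    shifted : ∀ y → u ≤ dist c y → u + dist (c ⊕ u) y ≡ dist c y
    shifted y u≤Y =
      trans (cong (_+ dist (c ⊕ u) y) (sym U)) (dist-+ c (c ⊕ u) y (subst (_≤ dist c y) (sym U) u≤Y))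

  edge-nonempty : ∀ {g} → Edge H g → ¬ (∀ y → y ∈ g → ⊥)
  edge-nonempty {g} eg g-empty = contradiction (begin
    suc (suc M)  ≡⟨ edge-size g eg ⟨
    ∣ g ∣        ≤⟨ p⊆q⇒∣p∣≤∣q∣ {q = ∅} (λ {y} y∈g → ⊥-elim (g-empty y y∈g)) ⟩
    ∣ ∅ {n} ∣    ≡⟨ ∣⊥∣≡0 n ⟩
    0            ∎) λ ()
    where open ≤-Reasoning

  M<n : M < n
  M<n = ≤-trans (≤-trans (n≤1+n (suc M)) (m≤m+n (suc (suc M)) _)) large

  probeAt : Fin n → ℕ → Subset n
  probeAt s d = probe s M (s ⊕ (M + d))

  InGap : Fin n → ℕ → Subset n → Set
  InGap s d g = ∀ y → y ∈ g → M < dist s y × dist s y < M + d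

  Beyond : Fin n → ℕ → Subset n → Set
  Beyond s d g = ∀ y → y ∈ g → M + d < dist s y

  copy-with-probe-after-block : ∀ s d {g y} → FormsCopy (probeAt s d) g → y ∈ g → M < dist s y
  copy-with-probe-after-block s d copy y∈g =
    ≰⇒> (λ Y≤M → copy-disjoint copy _ (∈probe-segment s M _ Y≤M) y∈g)

  ProbeEdgeBetween : Fin n → ℕ → ℕ → Set
  ProbeEdgeBetween s d₀ d₁ = ∃[ d ] (d₀ ≤ d × d ≤ d₁ × Edge H (probeAt s d))

  SweepResult : Fin n → ℕ → ℕ → Set
  SweepResult s d₀ d₁ =
    ProbeEdgeBetween s d₀ d₁ ⊎ (∃[ g ] (Edge H g × InGap s d₀ g)) ⊎ (∃[ g ] (Edge H g × Beyond s d₁ g))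

  probe-alternatives : ∀ s d → 0 < d → M + d < n → SweepResult s d d
  probe-alternatives s d 0<d M+d<n with Edge? (probeAt s d)
  ... | yes e = inj₁ (d , ≤-refl , ≤-refl , e)
  ... | no ¬e with completes-copy (probeAt s d)
                     (∣probe∣ s M _ M<n (subst (M <_) (sym (dist-⊕-< s M+d<n)) (m<m+n M 0<d))) ¬e
  ...   | g , eg , copy with copy-one-side s copy (∈probe-segment s M _ (≤-reflexive (dist-⊕-< s M<n)))
                               (∈probe-extra s M _)
                               (subst₂ _<_ (sym (dist-⊕-< s M<n)) (sym (dist-⊕-< s M+d<n)) (m<m+n M 0<d))
                               (λ y y∈g → subst (_< dist s y) (sym (dist-⊕-< s M<n))
                                            (copy-with-probe-after-block s d copy y∈g))
  ...     | inj₁ below = inj₂ (inj₁ (g , eg , λ y y∈g →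
              copy-with-probe-after-block s d copy y∈g , subst (dist s y <_) (dist-⊕-< s M+d<n) (below y y∈g)))
  ...     | inj₂ above = inj₂ (inj₂ (g , eg , λ y y∈g → subst (_< dist s y) (dist-⊕-< s M+d<n) (above y y∈g)))

  sweep : ∀ s {d₀} d₁ → 0 < d₀ → d₀ ≤ d₁ → M + d₁ < n → SweepResult s d₀ d₁
  sweep s zero 0<d₀ d₀≤0 _ = contradiction d₀≤0 (<⇒≱ 0<d₀)
  sweep s (suc d₁) 0<d₀ d₀≤1+d₁ bound with m≤n⇒m<n∨m≡n d₀≤1+d₁
  ... | inj₂ refl = probe-alternatives s (suc d₁) 0<d₀ bound
  ... | inj₁ d₀<1+d₁ with sweep s d₁ 0<d₀ (s≤s⁻¹ d₀<1+d₁) (<-trans (+-monoʳ-< M (n<1+n d₁)) bound)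
  ... | inj₁ (d , d₀≤d , d≤d₁ , e) = inj₁ (d , d₀≤d , m≤n⇒m≤1+n d≤d₁ , e)
  ... | inj₂ (inj₁ gap) = inj₂ (inj₁ gap)
  ... | inj₂ (inj₂ (g , eg , g-beyond)) with probe-alternatives s (suc d₁) z<s bound
  ...   | inj₁ (d , 1+d₁≤d , d≤1+d₁ , e) = inj₁ (d , ≤-trans (<⇒≤ d₀<1+d₁) 1+d₁≤d , d≤1+d₁ , e)
  ...   | inj₂ (inj₂ beyond) = inj₂ (inj₂ beyond)
  ...   | inj₂ (inj₁ (g′ , eg′ , g′-gap)) = ⊥-elim (no-copy g′ g eg′ eg (inj₁
          (separated⇒copy s (m<m+n M (<-≤-trans 0<d₀ (s≤s⁻¹ d₀<1+d₁)))
            (<-trans (+-monoʳ-< M (n<1+n d₁)) bound)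
            (λ y y∈g′ → let (M<Y , Y<M+1+d₁) = g′-gap y y∈g′ in
                         <⇒≤ M<Y , s≤s⁻¹ (subst (dist s y <_) (+-suc M d₁) Y<M+1+d₁))
            g-beyond)))

  end : ℕ
  end = suc (suc (suc M)) + o

  1+M+end≡n : suc (M + end) ≡ n
  1+M+end≡n = trans (solve 2 (λ M o → con 1 :+ (M :+ ((con 3 :+ M) :+ o)) := con 2 :* (con 2 :+ M) :+ o)
                            refl M o) n≡
    where open +-*-Solver

  M+end<n : M + end < n
  M+end<n = ≤-reflexive 1+M+end≡n

  M+1+M<n : M + suc M < n
  M+1+M<n = ≤-<-trans (+-monoʳ-≤ M (≤-trans (≤-trans (n≤1+n (suc M)) (n≤1+n _)) (m≤m+n _ o))) M+end<n

  no-edge-beyond-end : ∀ s {g} → Edge H g → ¬ Beyond s end g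
  no-edge-beyond-end s eg g-beyond =
    edge-nonempty eg λ y y∈g → <⇒≱ (dist<n s y) (subst (_≤ dist s y) 1+M+end≡n (g-beyond y y∈g))

  no-edge-in-unit-gap : ∀ s {g} → Edge H g → ¬ InGap s 1 g
  no-edge-in-unit-gap s eg g-gap = edge-nonempty eg λ y y∈g →
    let (M<Y , Y<M+1) = g-gap y y∈g in <⇒≱ M<Y (s≤s⁻¹ (subst (dist s y <_) (+-comm M 1) Y<M+1))

  covered : ∀ i → ∃[ h ] (Edge H h × i ∈ h)
  covered i with sweep (i ⊖ M) end z<s (s≤s z≤n) M+end<n
  ... | inj₁ (d , _ , _ , e) =
    probeAt (i ⊖ M) d , e , ∈probe-segment (i ⊖ M) M _ (≤-reflexive (dist-⊖ i M<n))
  ... | inj₂ (inj₁ (g , eg , g-gap)) = ⊥-elim (no-edge-in-unit-gap (i ⊖ M) eg g-gap)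
  ... | inj₂ (inj₂ (g , eg , g-beyond)) = ⊥-elim (no-edge-beyond-end (i ⊖ M) eg g-beyond)

  probe-past-λ-not-edge : ∀ {i l} s d → dist s i ≡ M → IsLambda H i l →
    M ≤ dist s l → dist s l < M + d → M + d < n → ¬ Edge H (probeAt s d)
  probe-past-λ-not-edge {i} {l} s d S-i is-λ M≤L L<M+d M+d<n e =
    proj₂ is-λ (probeAt s d , e , ∈probe-segment s M _ (≤-reflexive S-i) , within)
    where
    L+1 : dist s (l ⊕ 1) ≡ suc (dist s l)
    L+1 = trans (dist-shift s l 1 (subst (_< n) (+-comm 1 (dist s l)) (≤-<-trans L<M+d M+d<n)))
                (+-comm (dist s l) 1)
    I<L+1 : dist s i < dist s (l ⊕ 1)
    I<L+1 = subst₂ _<_ (sym S-i) (sym L+1) (s≤s M≤L)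
    within : ⊆Closed (probeAt s d) (l ⊕ 1) i
    within y y∈ with ∈probe⁻ s M _ y∈
    ... | inj₁ Y≤M =
      ArcCoords⇒InClosed s (l ⊕ 1) i y (inj₂ (inj₂ (subst (dist s y ≤_) (sym S-i) Y≤M , I<L+1)))
    ... | inj₂ refl = ArcCoords⇒InClosed s (l ⊕ 1) i y (inj₂ (inj₁ (I<L+1 ,
                        subst₂ _≤_ (sym L+1) (sym (dist-⊕-< s M+d<n)) L<M+d)))

  probe-before-ρ-not-edge : ∀ {i p} d → IsRho H i p → M + d < dist i p → ¬ Edge H (probeAt i d)
  probe-before-ρ-not-edge {i} {p} d is-ρ M+d<P e =
    proj₂ is-ρ (probeAt i d , e , ∈probe-segment i M _ (subst (_≤ M) (sym (dist-self i)) z≤n) , within)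
    where
    before-p : ∀ y → dist i y < dist i p → dist i y ≤ dist i (p ⊖ 1)
    before-p y Y<P = s≤s⁻¹ (subst (dist i y <_) (sym (dist-⊖1 i p (≤-<-trans z≤n M+d<P))) Y<P)
    within : ⊆Closed (probeAt i d) i (p ⊖ 1)
    within y y∈ with ∈probe⁻ i M _ y∈
    ... | inj₁ Y≤M = before-p y (≤-<-trans Y≤M (≤-<-trans (m≤m+n M d) M+d<P))
    ... | inj₂ refl = before-p y (subst (_< dist i p) (sym (dist-⊕-< i (<-trans M+d<P (dist<n i p)))) M+d<P)

  M<dist[λ,i] : ∀ {i l} → IsLambda H i l → M < dist l i
  M<dist[λ,i] {i} {l} ((h , eh , _ , h⊆) , _) =
    s≤s⁻¹ (edge-span l (suc (dist l i)) eh λ y y∈h → s≤s (h⊆ y y∈h))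

  M<dist[i,ρ] : ∀ {i p} → IsRho H i p → M < dist i p
  M<dist[i,ρ] {i} {p} ((h , eh , _ , h⊆) , _) =
    s≤s⁻¹ (edge-span i (suc (dist i p)) eh λ y y∈h → s≤s (h⊆ y y∈h))

  λ≢i : ∀ {i l} → IsLambda H i l → l ≢ i
  λ≢i is-λ = 0<dist⇒≢ (≤-<-trans z≤n (M<dist[λ,i] is-λ))

  i≢ρ : ∀ {i p} → IsRho H i p → i ≢ p
  i≢ρ is-ρ = 0<dist⇒≢ (≤-<-trans z≤n (M<dist[i,ρ] is-ρ))

  1+M<dist[i,λ] : ∀ {i l} → IsLambda H i l → suc M < dist i l
  1+M<dist[i,λ] {i} {l} is-λ = ≰⇒> λ L≤1+M → outcome L≤1+M (sweep s end z<s 2+M≤end M+end<n)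
    where
    s = i ⊖ M
    S-i : dist s i ≡ M
    S-i = dist-⊖ i M<n
    2+M≤end : suc (suc M) ≤ end
    2+M≤end = ≤-trans (n≤1+n _) (m≤m+n _ o)
    outcome : dist i l ≤ suc M → SweepResult s (suc (suc M)) end → ⊥
    outcome L≤1+M (inj₁ (d , 2+M≤d , d≤end , e)) =
      probe-past-λ-not-edge s d S-i is-λ (subst (M ≤_) S-l (m≤m+n M _))
        (subst (_< M + d) S-l (+-monoʳ-< M (≤-<-trans L≤1+M 2+M≤d)))
        (≤-<-trans (+-monoʳ-≤ M d≤end) M+end<n) e
      where
      S-l : M + dist i l ≡ dist s l
      S-l = dist-⊖-+-< i l (≤-<-trans (+-monoʳ-≤ M L≤1+M) M+1+M<n)
    outcome _ (inj₂ (inj₁ (g , eg , g-gap))) = contradiction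
      (edge-span-from s (suc M) (suc M) (≤-<-trans (m≤n+m (suc M) M) M+1+M<n) eg λ y y∈g →
         let (M<Y , Y<) = g-gap y y∈g in M<Y , subst (dist s y <_) (+-suc M (suc M)) Y<)
      (<-irrefl refl)
    outcome _ (inj₂ (inj₂ (g , eg , g-beyond))) = no-edge-beyond-end s eg g-beyond

  1+M<dist[ρ,i] : ∀ {i p} → IsRho H i p → suc M < dist p i
  1+M<dist[ρ,i] {i} {p} is-ρ = ≰⇒> λ D≤1+M →
    outcome (ahead D≤1+M) (sweep i d₁ z<s (s≤s z≤n) (<-trans (ahead D≤1+M) (dist<n i p)))
    where
    d₁ = suc (suc o)
    u+w≡n : suc (M + d₁) + suc M ≡ n
    u+w≡n = trans (solve 2 (λ M o → (con 1 :+ (M :+ (con 2 :+ o))) :+ (con 1 :+ M) := con 2 :* (con 2 :+ M) :+ o)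
                        refl M o) n≡
      where open +-*-Solver
    ahead : dist p i ≤ suc M → M + d₁ < dist i p
    ahead D≤1+M = +-cancelʳ-≤ (suc M) _ _ (begin
      suc (M + d₁) + suc M     ≡⟨ u+w≡n ⟩
      n                        ≡⟨ dist+dist≡n i p (i≢ρ is-ρ) ⟨
      dist i p + dist p i      ≤⟨ +-monoʳ-≤ (dist i p) D≤1+M ⟩
      dist i p + suc M         ∎)
      where open ≤-Reasoning
    outcome : M + d₁ < dist i p → SweepResult i 1 d₁ → ⊥
    outcome M+d₁<P (inj₁ (d , _ , d≤d₁ , e)) =
      probe-before-ρ-not-edge d is-ρ (≤-<-trans (+-monoʳ-≤ M d≤d₁) M+d₁<P) e
    outcome _ (inj₂ (inj₁ (g , eg , g-gap))) = no-edge-in-unit-gap i eg g-gap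
    outcome _ (inj₂ (inj₂ (g , eg , g-beyond))) = contradiction
      (edge-span-from i (suc (M + d₁)) (suc M) (<-≤-trans (m<m+n _ z<s) (≤-reflexive u+w≡n)) eg λ y y∈g →
         g-beyond y y∈g , subst (dist i y <_) (sym u+w≡n) (dist<n i y))
      (<-irrefl refl)

  λ-outside-window : ∀ {i l} → IsLambda H i l → ¬ InClosed (i ⊖ M) (i ⊕ suc M) l
  λ-outside-window {i} is-λ l∈window with ∈window i M (suc M) M+1+M<n l∈window
  ... | inj₁ D≤M = <⇒≱ (M<dist[λ,i] is-λ) D≤M
  ... | inj₂ D≤1+M = <⇒≱ (1+M<dist[i,λ] is-λ) D≤1+M

  ρ-outside-window : ∀ {i p} → IsRho H i p → ¬ InClosed (i ⊖ suc M) (i ⊕ M) p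
  ρ-outside-window {i} is-ρ p∈window
    with ∈window i (suc M) M (subst (_< n) (+-comm M (suc M)) M+1+M<n) p∈window
  ... | inj₁ D≤1+M = <⇒≱ (1+M<dist[ρ,i] is-ρ) D≤1+M
  ... | inj₂ D≤M = <⇒≱ (M<dist[i,ρ] is-ρ) D≤M

  edge-between-i-and-λ : ∀ {i l} → IsLambda H i l → suc (M + suc (dist i l)) ≤ n →
    ∃[ g ] (Edge H g × ∀ y → y ∈ g → dist i y ≤ dist i l)
  edge-between-i-and-λ {i} {l} is-λ room = outcome (sweep s end z<s 1+L≤end M+end<n)
    where
    s = i ⊖ M
    L = dist i l
    S-i : dist s i ≡ M
    S-i = dist-⊖ i M<n
    1+L≤end : suc L ≤ end
    1+L≤end = +-cancelˡ-≤ M _ _ (s≤s⁻¹ (subst (suc (M + suc L) ≤_) (sym 1+M+end≡n) room))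
    S-l : M + L ≡ dist s l
    S-l = dist-⊖-+-< i l (<-trans (+-monoʳ-< M (n<1+n L)) room)
    outcome : SweepResult s (suc L) end → ∃[ g ] (Edge H g × ∀ y → y ∈ g → dist i y ≤ L)
    outcome (inj₁ (d , 1+L≤d , d≤end , e)) = ⊥-elim (probe-past-λ-not-edge s d S-i is-λ
      (subst (M ≤_) S-l (m≤m+n M L)) (subst (_< M + d) S-l (+-monoʳ-< M 1+L≤d))
      (≤-<-trans (+-monoʳ-≤ M d≤end) M+end<n) e)
    outcome (inj₂ (inj₁ (g , eg , g-gap))) = g , eg , λ y y∈g →
      let (M<Y , Y<M+1+L) = g-gap y y∈g in
      s≤s⁻¹ (+-cancelˡ-< M _ _ (subst (_< M + suc L) (sym (dist-⊖-+ i y M<n (<⇒≤ M<Y))) Y<M+1+L))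
    outcome (inj₂ (inj₂ (g , eg , g-beyond))) = ⊥-elim (no-edge-beyond-end s eg g-beyond)

  edge-from-ρ : ∀ {i p} → IsRho H i p → suc M < dist i p →
    ∃[ g ] (Edge H g × ∀ y → y ∈ g → dist i p ≤ dist i y)
  edge-from-ρ {i} {p} is-ρ 1+M<P with m≤n⇒∃[o]m+o≡n 1+M<P
  ... | k , 2+M+k≡P = outcome (sweep i (suc k) z<s (s≤s z≤n) (<-trans M+1+k<P (dist<n i p)))
    where
    M+1+k<P : M + suc k < dist i p
    M+1+k<P = ≤-reflexive (trans (cong suc (+-suc M k)) 2+M+k≡P)
    outcome : SweepResult i 1 (suc k) → ∃[ g ] (Edge H g × ∀ y → y ∈ g → dist i p ≤ dist i y)
    outcome (inj₁ (d , _ , d≤1+k , e)) =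
      ⊥-elim (probe-before-ρ-not-edge d is-ρ (≤-<-trans (+-monoʳ-≤ M d≤1+k) M+1+k<P) e)
    outcome (inj₂ (inj₁ (g , eg , g-gap))) = ⊥-elim (no-edge-in-unit-gap i eg g-gap)
    outcome (inj₂ (inj₂ (g , eg , g-beyond))) = g , eg , λ y y∈g →
      subst (_≤ dist i y) (trans (cong suc (+-suc M k)) 2+M+k≡P) (g-beyond y y∈g)

  ρ-not-past-λ : ∀ {i l p} → IsLambda H i l → IsRho H i p → dist i p ≤ dist i l
  ρ-not-past-λ {i} {l} {p} is-λ is-ρ = ≮⇒≥ λ L<P →
    let (g₁ , eg₁ , g₁-up-to-L) = edge-between-i-and-λ is-λ (<⇒≤ (room L<P))
        (g₂ , eg₂ , g₂-from-P) = edge-from-ρ is-ρ (<-trans (1+M<dist[i,λ] is-λ) L<P)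
    in no-copy g₁ g₂ eg₁ eg₂ (inj₁ (separated⇒copy i (≤-<-trans z≤n (1+M<dist[i,λ] is-λ)) (dist<n i l)
         (λ y y∈g₁ → z≤n , g₁-up-to-L y y∈g₁) (λ y y∈g₂ → <-≤-trans L<P (g₂-from-P y y∈g₂))))
    where
    L = dist i l
    P = dist i p
    room : L < P → suc (M + suc L) < n
    room L<P = begin-strict
      suc M + suc L            ≡⟨ +-comm (suc M) (suc L) ⟩
      suc L + suc M            <⟨ +-mono-≤-< L<P (1+M<dist[ρ,i] is-ρ) ⟩
      P + dist p i             ≡⟨ dist+dist≡n i p (i≢ρ is-ρ) ⟩
      n                        ∎
      where open ≤-Reasoning

  λ-i-ρ-in-order : ∀ {i l p} → IsLambda H i l → IsRho H i p →
    (l ≢ i) × (p ≢ i) × (p ≡ l ⊎ Cyc3 l i p)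
  λ-i-ρ-in-order {i} {l} {p} is-λ is-ρ = λ≢i is-λ , ≢-sym (i≢ρ is-ρ) , order
    where
    L = dist i l
    P = dist i p
    0<D[l,i] : 0 < dist l i
    0<D[l,i] = ≤-<-trans z≤n (M<dist[λ,i] is-λ)
    0<P : 0 < P
    0<P = ≤-<-trans z≤n (M<dist[i,ρ] is-ρ)
    order : p ≡ l ⊎ Cyc3 l i p
    order with m≤n⇒m<n∨m≡n (ρ-not-past-λ is-λ is-ρ)
    ... | inj₂ P≡L = inj₁ (dist-injective i P≡L)
    ... | inj₁ P<L = inj₂ (0<D[l,i] , +-cancelˡ-< L _ _ (begin-strict
      L + dist l i  ≡⟨ dist+dist≡n i l (≢-sym (λ≢i is-λ)) ⟩
      n             <⟨ m<n+m n 0<P ⟩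
      P + n         ≡⟨ dist-+-wrap i l p P<L ⟨
      L + dist l p  ∎))
      where open ≤-Reasoning

  no-copy-through-i-and-[ρ,λ] : ∀ {i j l p e g} → IsLambda H i l → IsRho H i p → InClosed p l j →
    i ∈ e → j ∈ e → Edge H g → ¬ FormsCopy e g
  no-copy-through-i-and-[ρ,λ] {i} {j} {l} {p} {e} {g}
    is-λ@((hλ , ehλ , _ , hλ⊆) , _) is-ρ@((hρ , ehρ , _ , hρ⊆) , _) j∈[p,l] i∈e j∈e eg copy =
    [ below-j , above-j ]′ (copy-one-side i copy i∈e j∈e (subst (_< dist i j) (sym (dist-self i)) 0<J)
                              (λ y y∈g → subst (_< dist i y) (sym (dist-self i)) (g-after-i y y∈g)))
    where
    P≤J≤L : dist i p ≤ dist i j × dist i j ≤ dist i l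
    P≤J≤L = closed-straight i (ρ-not-past-λ is-λ is-ρ) j∈[p,l]
    0<J : 0 < dist i j
    0<J = <-≤-trans (≤-<-trans z≤n (M<dist[i,ρ] is-ρ)) (proj₁ P≤J≤L)
    g-after-i : ∀ y → y ∈ g → 0 < dist i y
    g-after-i y y∈g = n≢0⇒n>0 λ Y≡0 → copy-dist-≢ i copy i∈e y∈g (trans (dist-self i) (sym Y≡0))
    below-j : (∀ y → y ∈ g → dist i y < dist i j) → ⊥
    below-j below = no-copy hλ g ehλ eg (inj₁
      (separated⇒copy l (≤-<-trans z≤n (M<dist[λ,i] is-λ)) (dist<n l i)
         (λ y y∈hλ → z≤n , hλ⊆ y y∈hλ) g-after-λ))
      where
      g-after-λ : ∀ y → y ∈ g → dist l i < dist l y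
      g-after-λ y y∈g = subst (dist l i <_) (dist-+-< l i y around) (m<m+n (dist l i) (g-after-i y y∈g))
        where
        around : dist l i + dist i y < n
        around = begin-strict
          dist l i + dist i y  <⟨ +-monoʳ-< (dist l i) (<-≤-trans (below y y∈g) (proj₂ P≤J≤L)) ⟩
          dist l i + dist i l  ≡⟨ dist+dist≡n l i (λ≢i is-λ) ⟩
          n                    ∎
          where open ≤-Reasoning
    above-j : (∀ y → y ∈ g → dist i j < dist i y) → ⊥
    above-j above = no-copy hρ g ehρ eg (inj₁
      (separated⇒copy i (≤-<-trans z≤n (M<dist[i,ρ] is-ρ)) (dist<n i p)
         (λ y y∈hρ → z≤n , hρ⊆ y y∈hρ) (λ y y∈g → ≤-<-trans (proj₁ P≤J≤L) (above y y∈g))))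

  through-i-and-[ρ,λ]⇒edge : ∀ {i j l p} → IsLambda H i l → IsRho H i p → InClosed p l j →
    ∀ e → ∣ e ∣ ≡ suc (suc M) → i ∈ e → j ∈ e → Edge H e
  through-i-and-[ρ,λ]⇒edge is-λ is-ρ j∈[p,l] e size i∈e j∈e with Edge? e
  ... | yes e∈H = e∈H
  ... | no e∉H with completes-copy e size e∉H
  ...   | g , eg , copy = ⊥-elim (no-copy-through-i-and-[ρ,λ] is-λ is-ρ j∈[p,l] i∈e j∈e eg copy)

proposition3p4 : (r n : ℕ) .{{_ : NonZero n}} → 2 ≤ r → 2 * r ≤ n
    → (H : Hypergraph {n}) → Saturated r H
    → (∀ (i : Fin n) → ∃[ h ] (Edge H h × i ∈ h))
      × (∀ (i l : Fin n) → IsLambda H i l → ¬ InClosed (i ⊖ (r ∸ 2)) (i ⊕ (r ∸ 1)) l)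
      × (∀ (i p : Fin n) → IsRho H i p → ¬ InClosed (i ⊖ (r ∸ 1)) (i ⊕ (r ∸ 2)) p)
      × (∀ (i l p : Fin n) → IsLambda H i l → IsRho H i p
          → (l ≢ i) × (p ≢ i) × (p ≡ l ⊎ Cyc3 l i p))
      × (∀ (i j l p : Fin n) → IsLambda H i l → IsRho H i p → InClosed p l j
          → ∀ (e : Subset n) → ∣ e ∣ ≡ r → i ∈ e → j ∈ e → Edge H e)
proposition3p4 (suc (suc M)) n (s≤s (s≤s z≤n)) large H (edge-size , no-copy , completes-copy) =
    covered
  , (λ _ _ → λ-outside-window)
  , (λ _ _ → ρ-outside-window)
  , (λ _ _ _ → λ-i-ρ-in-order)
  , (λ _ _ _ _ → through-i-and-[ρ,λ]⇒edge)
  where open SaturatedHypergraph M large H edge-size no-copy completes-copy
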